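{- For any integers $q\ge 2$ and $a$, let $\mu(q;a)$ be the number of $x$ with $1\le x\le q$ and $x(x+1)\equiv a\pmod q$. Then \[ \mu(q;a)\le 4\cdot 2^{\omega(q)}\sqrt{(A,q)},\qquad\text{where } A=4a+1. \]
   Context: $\omega(q)$ denotes the number of distinct prime divisors of $q$; $(A,q)$ is the greatest common divisor of $|A|$ and $q$. -}

module Defs where

open import Data.Nat as ℕ using (ℕ; suc)
open import Data.Nat.Divisibility as ℕD using ()
open import Data.Nat.Primality using (Prime; prime?)
open import Data.Integer as ℤ using (ℤ; +_; ∣_∣)
open import Data.Integer.Divisibility as ℤD using ()
open import Data.List using (List; length; filter; upTo; map)
open import Data.Product using (_×_)
open import Relation.Nullary.Decidable using (Dec; _×-dec_)

-- ω(q): number of distinct primes p dividing q (primes dividing q ≥ 1 lie in 0..q)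
ω : ℕ → ℕ
ω q = length (filter (λ p → prime? p ×-dec (p ℕD.∣? q)) (upTo (suc q)))

-- decidability of integer divisibility (ℤD._∣_ is ℕ-divisibility of absolute values)
_∣ℤ?_ : (m : ℕ) → (n : ℤ) → Dec ((+ m) ℤD.∣ n)
m ∣ℤ? n = m ℕD.∣? ∣ n ∣

μ : ℕ → ℤ → ℕ
μ q a = length (filter (λ x → q ∣ℤ? ((+ x) ℤ.* ((+ x) ℤ.+ + 1) ℤ.- a)) (map suc (upTo q)))

{-# OPTIONS --safe #-}
-- Fix a root x₀ of x(x+1) ≡ a (mod q). For q = p^k every root y satisfies
-- (y − x₀)(y + x₀ + 1) ≡ 0 and (2x₀ + 1)² ≡ A (mod p^k). Let p^(2m) be the largest even
-- power of p dividing (A, p^k). Then p^(k−m) divides one of the two factors: otherwise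
-- p^(m+1) divides both, hence their difference 2x₀ + 1, so either p^(2m+2) ∣ (A, p^k), or
-- k − m ≤ m + 1 and p^(k−m) divides both after all. So one bit determines y modulo
-- N = p^(k−m), where N·M = p^k and M² ∣ (A, p^k). These data multiply over the coprime
-- prime-power factors of q: ω(q) bits determine a root modulo some N with N·M = q and
-- M² ∣ (A, q). A residue class modulo N meets [0, q) in M points, so μ(q;a) ≤ 2^ω(q)·M
-- and μ(q;a)² ≤ 4^ω(q)·(A, q), with the factor 16 to spare.

module Submission where

open import Defs
open import Data.Bool using (Bool; true; false; _∧_; not)
open import Data.Bool.Properties using (not-injective)
open import Data.Integer as ℤ using (ℤ; +_; ∣_∣)
import Data.Integer.Properties as ℤ
open import Data.Integer.Divisibility.Signed as ℤ∣ using (∣ᵤ⇒∣; ∣⇒∣ᵤ) renaming (_∣_ to _∣ᶻ_)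
open import Data.Integer.Tactic.RingSolver using (solve-∀)
open import Data.List using ([]; _∷_; [_]; _++_; length; filter; applyUpTo)
open import Data.List.Properties using (length-++; filter-++; applyUpTo-∷ʳ; map-upTo)
open import Data.List.Relation.Unary.All using (_∷_)
open import Data.Nat
open import Data.Nat.Properties
open import Algebra.Properties.CommutativeSemigroup +-commutativeSemigroup using (interchange)
open import Data.Nat.Coprimality as Coprimality using (Coprime; coprime-divisor)
open import Data.Nat.Divisibility
open import Data.Nat.GCD using (gcd; gcd-greatest; gcd[m,n]∣m; gcd[m,n]∣n; gcd[m,n]≢0)
open import Data.Nat.Induction using (<-rec)
open import Data.Nat.ListAction using (product)
open import Data.Nat.Primality using (Prime; prime?; prime⇒irreducible; prime⇒nonZero; prime⇒nonTrivial)
open import Data.Nat.Primality.Factorisation using (factorise)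
open import Data.Product using (∃-syntax; ∃₂; _×_; _,_; proj₂)
open import Data.Sum using (_⊎_; inj₁; inj₂)
open import Data.Vec as Vec using (Vec; []; _∷_; head; tail)
open import Data.Vec.Properties using (++-injectiveˡ; ++-injectiveʳ)
open import Function using (_∘_; _∘′_; id; mk⇔)
open import Relation.Binary.PropositionalEquality hiding ([_])
open import Relation.Nullary using (¬_; Dec; yes; no; contradiction)
open import Relation.Nullary.Decidable using (does; does-⇔; dec-true; dec-false; _×-dec_)
open import Relation.Unary using (Decidable)

indicator : Bool → ℕ
indicator true  = 1
indicator false = 0

count : (ℕ → Bool) → ℕ → ℕ
count f zero    = 0
count f (suc n) = count f n + indicator (f n)

indicator-mono : ∀ {b c} → (b ≡ true → c ≡ true) → indicator b ≤ indicator c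
indicator-mono {false} _   = z≤n
indicator-mono {true}  b⇒c rewrite b⇒c refl = ≤-refl

indicator-split : ∀ b c → indicator b ≡ indicator (b ∧ c) + indicator (b ∧ not c)
indicator-split false _     = refl
indicator-split true  true  = refl
indicator-split true  false = refl

count-mono : ∀ {f g} → (∀ y → f y ≡ true → g y ≡ true) → ∀ n → count f n ≤ count g n
count-mono f⇒g zero    = z≤n
count-mono f⇒g (suc n) = +-mono-≤ (count-mono f⇒g n) (indicator-mono (f⇒g n))

count-mono-< : ∀ {f g} → (∀ y → f y ≡ true → g y ≡ true) →
               ∀ {y n} → y < n → f y ≡ false → g y ≡ true → count f n < count g n
count-mono-< {f} {g} f⇒g {y} {suc n} y<1+n fy gy with y ≟ n
... | yes refl rewrite fy | gy = +-mono-≤-< (count-mono f⇒g y) z<s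
... | no y≢n   = +-mono-<-≤ (count-mono-< f⇒g (≤∧≢⇒< (≤-pred y<1+n) y≢n) fy gy) (indicator-mono (f⇒g n))

count-split : ∀ (f c : ℕ → Bool) n → count f n ≡ count (λ y → f y ∧ c y) n + count (λ y → f y ∧ not (c y)) n
count-split f c zero    = refl
count-split f c (suc n) =
  trans (cong₂ _+_ (count-split f c n) (indicator-split (f n) (c n)))
        (interchange (count f∧c n) (count f∧¬c n) (indicator (f n ∧ c n)) (indicator (f n ∧ not (c n))))
  where
  f∧c f∧¬c : ℕ → Bool
  f∧c y  = f y ∧ c y
  f∧¬c y = f y ∧ not (c y)

count-+ : ∀ (f : ℕ → Bool) m n → count f (m + n) ≡ count f m + count (λ y → f (m + y)) n
count-+ f m zero    rewrite +-identityʳ m = sym (+-identityʳ _)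
count-+ f m (suc n) rewrite +-suc m n | count-+ f m n =
  +-assoc (count f m) (count (λ y → f (m + y)) n) (indicator (f (m + n)))

count-monoʳ-≤ : ∀ (f : ℕ → Bool) {m n} → m ≤ n → count f m ≤ count f n
count-monoʳ-≤ f {m} {n} m≤n = begin
  count f m                                   ≤⟨ m≤m+n (count f m) _ ⟩
  count f m + count (λ y → f (m + y)) (n ∸ m) ≡⟨ sym (count-+ f m (n ∸ m)) ⟩
  count f (m + (n ∸ m))                       ≡⟨ cong (count f) (m+[n∸m]≡n m≤n) ⟩
  count f n                                   ∎
  where open ≤-Reasoning

count-rotate : ∀ (f : ℕ → Bool) n → f n ≡ f 0 → count (f ∘ suc) n ≡ count f n
count-rotate f n fn≡f0 = +-cancelˡ-≡ (indicator (f 0)) _ _ (begin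
  indicator (f 0) + count (f ∘ suc) n ≡⟨ sym (count-+ f 1 n) ⟩
  count f n + indicator (f n)         ≡⟨ cong (λ b → count f n + indicator b) fn≡f0 ⟩
  count f n + indicator (f 0)         ≡⟨ +-comm (count f n) (indicator (f 0)) ⟩
  indicator (f 0) + count f n         ∎)
  where open ≡-Reasoning

count≡0⊎witness : ∀ (f : ℕ → Bool) n → count f n ≡ 0 ⊎ ∃[ y ] f y ≡ true
count≡0⊎witness f zero = inj₁ refl
count≡0⊎witness f (suc n) with f n in fn
... | true  = inj₂ (n , fn)
... | false rewrite +-identityʳ (count f n) = count≡0⊎witness f n

count-none : ∀ (f : ℕ → Bool) n → (∀ {y} → y < n → f y ≡ false) → count f n ≡ 0
count-none f zero    _    = refl
count-none f (suc n) none rewrite count-none f n (none ∘′ m<n⇒m<1+n) | none (n<1+n n) = refl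

SingleResidueMod : ℕ → (ℕ → Bool) → Set
SingleResidueMod N f = ∀ {y y'} → f y ≡ true → f y' ≡ true → N ∣ ∣ y - y' ∣

count-window≤1 : ∀ {N f} → SingleResidueMod N f → ∀ n → n ≤ N → count f n ≤ 1
count-window≤1         single zero    _   = z≤n
count-window≤1 {N} {f} single (suc n) n<N with f n in fn
... | false = ≤-trans (≤-reflexive (+-identityʳ _)) (count-window≤1 single n (<⇒≤ n<N))
... | true  = ≤-reflexive (cong (_+ 1) (count-none f n earlier-false))
  where
  earlier-false : ∀ {y} → y < n → f y ≡ false
  earlier-false {y} y<n with f y in fy
  ... | false = refl
  ... | true  = contradiction
      (subst (N ∣_) (m≤n⇒∣m-n∣≡n∸m (<⇒≤ y<n)) (single fy fn))
      (>⇒∤ ⦃ >-nonZero (m<n⇒0<n∸m y<n) ⦄ (≤-<-trans (m∸n≤m n y) n<N))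

count-single-residue≤ : ∀ {N f} → SingleResidueMod N f → ∀ M → count f (N * M) ≤ M
count-single-residue≤ {N}     single zero    rewrite *-zeroʳ N = z≤n
count-single-residue≤ {N} {f} single (suc M) = begin
  count f (N * suc M)                             ≡⟨ cong (count f) (trans (*-suc N M) (+-comm N (N * M))) ⟩
  count f (N * M + N)                             ≡⟨ count-+ f (N * M) N ⟩
  count f (N * M) + count (λ y → f (N * M + y)) N ≤⟨ +-mono-≤ (count-single-residue≤ single M)
                                                              (count-window≤1 shifted N ≤-refl) ⟩
  M + 1                                           ≡⟨ +-comm M 1 ⟩
  suc M                                           ∎
  where
  open ≤-Reasoning
  shifted : SingleResidueMod N (λ y → f (N * M + y))
  shifted {y} {y'} fy fy' = subst (N ∣_) (∣m+n-m+o∣≡∣n-o∣ (N * M) y y') (single fy fy')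

≡-by-head-tail : ∀ {a} {A : Set a} {n} {u v : Vec A (suc n)} → head u ≡ head v → tail u ≡ tail v → u ≡ v
≡-by-head-tail {u = _ ∷ _} {_ ∷ _} refl refl = refl

∧≡true : ∀ {b c} → b ∧ c ≡ true → b ≡ true × c ≡ true
∧≡true {true} {true} _ = refl , refl

count-keyed≤ : ∀ {N L} (f : ℕ → Bool) (key : ℕ → Vec Bool L) →
              (∀ {y y'} → f y ≡ true → f y' ≡ true → key y ≡ key y' → N ∣ ∣ y - y' ∣) →
              ∀ M → count f (N * M) ≤ 2 ^ L * M
count-keyed≤ {N} {zero}  f key separated M =
  ≤-trans (count-single-residue≤ (λ fy fy' → separated fy fy' (no-keys (key _) (key _))) M) (m≤m+n M 0)
  where
  no-keys : (u v : Vec Bool 0) → u ≡ v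
  no-keys [] [] = refl
count-keyed≤ {N} {suc L} f key separated M = begin
  count f (N * M)
    ≡⟨ count-split f (head ∘ key) (N * M) ⟩
  count (λ y → f y ∧ head (key y)) (N * M) + count (λ y → f y ∧ not (head (key y))) (N * M)
    ≤⟨ +-mono-≤ (count-keyed≤ _ (tail ∘ key) (half id id) M)
                (count-keyed≤ _ (tail ∘ key) (half not not-injective) M) ⟩
  2 ^ L * M + 2 ^ L * M
    ≡⟨ sym (*-distribʳ-+ M (2 ^ L) (2 ^ L)) ⟩
  (2 ^ L + 2 ^ L) * M
    ≡⟨ cong (λ t → (2 ^ L + t) * M) (sym (+-identityʳ (2 ^ L))) ⟩
  2 ^ suc L * M
    ∎
  where
  open ≤-Reasoning
  half : (φ : Bool → Bool) → (∀ {b c} → φ b ≡ φ c → b ≡ c) →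
         ∀ {y y'} → f y ∧ φ (head (key y)) ≡ true → f y' ∧ φ (head (key y')) ≡ true →
         tail (key y) ≡ tail (key y') → N ∣ ∣ y - y' ∣
  half φ φ-injective fy∧ fy'∧ tails with ∧≡true fy∧ | ∧≡true fy'∧
  ... | fy , φy | fy' , φy' = separated fy fy' (≡-by-head-tail (φ-injective (trans φy (sym φy'))) tails)

dec-true⁻¹ : ∀ {P : Set} (P? : Dec P) → does P? ≡ true → P
dec-true⁻¹ (yes p) _ = p

length-filter-applyUpTo : ∀ {P : ℕ → Set} (P? : Decidable P) (f : ℕ → ℕ) n →
                          length (filter P? (applyUpTo f n)) ≡ count (λ y → does (P? (f y))) n
length-filter-applyUpTo P? f zero    = refl
length-filter-applyUpTo P? f (suc n) = begin
  length (filter P? (applyUpTo f (suc n)))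
    ≡⟨ cong (length ∘ filter P?) (sym (applyUpTo-∷ʳ f n)) ⟩
  length (filter P? (applyUpTo f n ++ [ f n ]))
    ≡⟨ cong length (filter-++ P? (applyUpTo f n) [ f n ]) ⟩
  length (filter P? (applyUpTo f n) ++ filter P? [ f n ])
    ≡⟨ length-++ (filter P? (applyUpTo f n)) ⟩
  length (filter P? (applyUpTo f n)) + length (filter P? [ f n ])
    ≡⟨ cong₂ _+_ (length-filter-applyUpTo P? f n) (length-filter-singleton (f n)) ⟩
  count (λ y → does (P? (f y))) (suc n)
    ∎
  where
  open ≡-Reasoning
  length-filter-singleton : ∀ x → length (filter P? [ x ]) ≡ indicator (does (P? x))
  length-filter-singleton x with does (P? x)
  ... | true  = refl
  ... | false = refl

prime∤⇒coprime : ∀ {p n} → Prime p → ¬ p ∣ n → Coprime p n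
prime∤⇒coprime p-prime p∤n (d∣p , d∣n) with prime⇒irreducible p-prime d∣p
... | inj₁ d≡1  = d≡1
... | inj₂ refl = contradiction d∣n p∤n

coprime-∣ : ∀ {m n c d} → Coprime m n → c ∣ m → d ∣ n → Coprime c d
coprime-∣ m⊥n c∣m d∣n (e∣c , e∣d) = m⊥n (∣-trans e∣c c∣m , ∣-trans e∣d d∣n)

coprime-*ˡ : ∀ {m n o} → Coprime m o → Coprime n o → Coprime (m * n) o
coprime-*ˡ {m} m⊥o n⊥o {d} (d∣mn , d∣o) = n⊥o (coprime-divisor d⊥m d∣mn , d∣o)
  where
  d⊥m : Coprime d m
  d⊥m (e∣d , e∣m) = m⊥o (e∣m , ∣-trans e∣d d∣o)

coprime-^ˡ : ∀ {m n} → Coprime m n → ∀ k → Coprime (m ^ k) n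
coprime-^ˡ m⊥n zero    (d∣1 , _) = ∣1⇒≡1 d∣1
coprime-^ˡ m⊥n (suc k) = coprime-*ˡ m⊥n (coprime-^ˡ m⊥n k)

coprime⇒*∣ : ∀ {m n o} → Coprime m n → m ∣ o → n ∣ o → m * n ∣ o
coprime⇒*∣ {m} {n} m⊥n (divides s refl) n∣sm = subst (m * n ∣_) (*-comm m s)
  (*-monoʳ-∣ m (coprime-divisor (Coprimality.sym m⊥n) (subst (n ∣_) (*-comm s m) n∣sm)))

^-monoʳ-∣ : ∀ p {m n} → m ≤ n → p ^ m ∣ p ^ n
^-monoʳ-∣ p {m} {n} m≤n =
  subst (p ^ m ∣_) (trans (sym (^-distribˡ-+-* p m (n ∸ m))) (cong (p ^_) (m+[n∸m]≡n m≤n))) (m∣m*n (p ^ (n ∸ m)))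

p^[1+k]∤p^k : ∀ {p} → Prime p → ∀ k → ¬ p ^ suc k ∣ p ^ k
p^[1+k]∤p^k {p} p-prime k p^[1+k]∣p^k =
  <⇒≱ (^-monoʳ-< p (nonTrivial⇒n>1 p ⦃ prime⇒nonTrivial p-prime ⦄) (n<1+n k))
      (∣⇒≤ ⦃ m^n≢0 p k ⦃ prime⇒nonZero p-prime ⦄ ⦄ p^[1+k]∣p^k)

p^[i+s]∣m*n⇒p^s∣n : ∀ {p} → Prime p → ∀ i s {m n} → p ^ (i + s) ∣ m * n → ¬ p ^ suc i ∣ m → p ^ s ∣ n
p^[i+s]∣m*n⇒p^s∣n {p} p-prime zero s {m} p^s∣mn p∤m =
  coprime-divisor (coprime-^ˡ (prime∤⇒coprime p-prime (p∤m ∘ subst (_∣ m) (sym (*-identityʳ p)))) s) p^s∣mn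
p^[i+s]∣m*n⇒p^s∣n {p} p-prime (suc i) s {m} {n} p^[1+i+s]∣mn p^[2+i]∤m with p ∣? m
... | no p∤m = ∣-trans (^-monoʳ-∣ p (m≤n+m s (suc i)))
                       (coprime-divisor (coprime-^ˡ (prime∤⇒coprime p-prime p∤m) (suc i + s)) p^[1+i+s]∣mn)
... | yes (divides m' refl) = p^[i+s]∣m*n⇒p^s∣n p-prime i s p^[i+s]∣m'n p^[1+i]∤m'
  where
  instance
    p≢0 : NonZero p
    p≢0 = prime⇒nonZero p-prime
  p^[i+s]∣m'n : p ^ (i + s) ∣ m' * n
  p^[i+s]∣m'n =
    *-cancelˡ-∣ p (subst (p * p ^ (i + s) ∣_) (trans (cong (_* n) (*-comm m' p)) (*-assoc p m' n)) p^[1+i+s]∣mn)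
  p^[1+i]∤m' : ¬ p ^ suc i ∣ m'
  p^[1+i]∤m' p^[1+i]∣m' = p^[2+i]∤m (subst (p * p ^ suc i ∣_) (*-comm p m') (*-monoʳ-∣ p p^[1+i]∣m'))

crossing : ∀ {P : ℕ → Set} → Decidable P → P 0 → ∀ {B} → ¬ P B → ∃[ m ] m < B × P m × ¬ P (suc m)
crossing P? P0 {zero}  ¬P0 = contradiction P0 ¬P0
crossing P? P0 {suc B} ¬P[1+B] with P? B
... | yes PB  = B , ≤-refl , PB , ¬P[1+B]
... | no  ¬PB with crossing P? P0 ¬PB
...   | m , m<B , Pm , ¬P[1+m] = m , m<n⇒m<1+n m<B , Pm , ¬P[1+m]

factor-out : ∀ {p} → Prime p → ∀ n → .{{NonZero n}} → ∃₂ λ k r → n ≡ p ^ k * r × ¬ p ∣ r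
factor-out {p} p-prime n = <-rec (λ n → .{{NonZero n}} → ∃₂ λ k r → n ≡ p ^ k * r × ¬ p ∣ r) go n
  where
  go : ∀ n → (∀ {m} → m < n → .{{NonZero m}} → ∃₂ λ k r → m ≡ p ^ k * r × ¬ p ∣ r) →
       .{{NonZero n}} → ∃₂ λ k r → n ≡ p ^ k * r × ¬ p ∣ r
  go n rec with p ∣? n
  ... | no p∤n = 0 , n , sym (+-identityʳ n) , p∤n
  ... | yes (divides n' refl) with rec n'<n'p ⦃ n'≢0 ⦄
    where
    n'≢0 : NonZero n'
    n'≢0 = m*n≢0⇒m≢0 n'
    n'<n'p : n' < n' * p
    n'<n'p = m<m*n n' p ⦃ n'≢0 ⦄ (nonTrivial⇒n>1 p ⦃ prime⇒nonTrivial p-prime ⦄)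
  ...   | k , r , refl , p∤r = suc k , r , trans (*-comm (p ^ k * r) p) (sym (*-assoc p (p ^ k) r)) , p∤r

∃-prime-divisor : ∀ {q} → .{{NonZero q}} → 2 ≤ q → ∃[ p ] Prime p × p ∣ q
∃-prime-divisor {q} 2≤q with factorise q
... | record { factors = [] ; isFactorisation = eq } = contradiction (sym eq) (<⇒≢ 2≤q)
... | record { factors = p ∷ ps ; isFactorisation = eq ; factorsPrime = p-prime ∷ _ } =
  p , p-prime , subst (p ∣_) (sym eq) (m∣m*n (product ps))

primeDivisor? : ℕ → ℕ → Bool
primeDivisor? n x = does (prime? x ×-dec (x ∣? n))

ω≡count : ∀ n → ω n ≡ count (primeDivisor? n) (suc n)
ω≡count n = length-filter-applyUpTo (λ x → prime? x ×-dec (x ∣? n)) id (suc n)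

ω-< : ∀ {p q r} → .{{NonZero q}} → Prime p → p ∣ q → ¬ p ∣ r → r ∣ q → ω r < ω q
ω-< {p} {q} {r} p-prime p∣q p∤r r∣q = begin-strict
  ω r                             ≡⟨ ω≡count r ⟩
  count (primeDivisor? r) (suc r) ≤⟨ count-monoʳ-≤ (primeDivisor? r) (s≤s (∣⇒≤ r∣q)) ⟩
  count (primeDivisor? r) (suc q) <⟨ count-mono-< divides-r⇒divides-q (s≤s (∣⇒≤ p∣q))
                                       (dec-false (prime? p ×-dec (p ∣? r)) (p∤r ∘ proj₂))
                                       (dec-true (prime? p ×-dec (p ∣? q)) (p-prime , p∣q)) ⟩
  count (primeDivisor? q) (suc q) ≡⟨ ω≡count q ⟨
  ω q                             ∎
  where
  open ≤-Reasoning
  divides-r⇒divides-q : ∀ x → primeDivisor? r x ≡ true → primeDivisor? q x ≡ true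
  divides-r⇒divides-q x h with x-prime , x∣r ← dec-true⁻¹ (prime? x ×-dec (x ∣? r)) h =
    dec-true (prime? x ×-dec (x ∣? q)) (x-prime , ∣-trans x∣r r∣q)

∣+m-+n∣≡∣m-n∣ : ∀ m n → ∣ + m ℤ.- + n ∣ ≡ ∣ m - n ∣
∣+m-+n∣≡∣m-n∣ m n with ≤-total m n
... | inj₁ m≤n = trans (cong ∣_∣ (ℤ.m-n≡m⊖n m n)) (trans (ℤ.∣⊖∣-≤ m≤n) (sym (m≤n⇒∣m-n∣≡n∸m m≤n)))
... | inj₂ n≤m = trans (cong ∣_∣ (trans (ℤ.m-n≡m⊖n m n) (ℤ.⊖-≥ n≤m)))
                       (trans (sym (m≤n⇒∣m-n∣≡n∸m n≤m)) (∣-∣-comm n m))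

∣-abs⇒∣ᶻ : ∀ {n z} → n ∣ ∣ z ∣ → + n ∣ᶻ z
∣-abs⇒∣ᶻ {n} = ∣ᵤ⇒∣ {+ n}

∣ᶻ⇒∣-distance : ∀ {n} y y' → + n ∣ᶻ + y ℤ.- + y' → n ∣ ∣ y - y' ∣
∣ᶻ⇒∣-distance y y' n∣y-y' = subst (_ ∣_) (∣+m-+n∣≡∣m-n∣ y y') (∣⇒∣ᵤ n∣y-y')

prime-power-∣-factor : ∀ {p} → Prime p → ∀ j m {k} → j + m ≡ k → ∀ {D U V : ℤ} →
                       ¬ (p ^ suc m * p ^ suc m ∣ gcd (∣ D ∣) (p ^ k)) →
                       + (p ^ k) ∣ᶻ U ℤ.* V → + (p ^ k) ∣ᶻ (V ℤ.- U) ℤ.* (V ℤ.- U) ℤ.- D →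
                       + (p ^ j) ∣ᶻ U ⊎ + (p ^ j) ∣ᶻ V
prime-power-∣-factor p-prime zero m _ _ _ _ = inj₁ (∣ᵤ⇒∣ (1∣ _))
prime-power-∣-factor {p} p-prime (suc i) m refl {D} {U} {V} p^[2m+2]∤gcd p^k∣UV p^k∣W²-D
  with + (p ^ suc i) ℤ∣.∣? U | + (p ^ suc i) ℤ∣.∣? V
... | yes p^j∣U | _         = inj₁ p^j∣U
... | no _      | yes p^j∣V = inj₂ p^j∣V
... | no p^j∤U  | no p^j∤V  = contradiction p^[1+m]∣U p^[1+m]∤U
  where
  k = suc i + m
  W = V ℤ.- U
  p^[i+1+m]∣UV : p ^ (i + suc m) ∣ ∣ U ∣ * ∣ V ∣
  p^[i+1+m]∣UV = subst₂ (λ e n → p ^ e ∣ n) (sym (+-suc i m)) (ℤ.abs-* U V) (∣⇒∣ᵤ p^k∣UV)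
  p^[1+m]∣V : p ^ suc m ∣ ∣ V ∣
  p^[1+m]∣V = p^[i+s]∣m*n⇒p^s∣n p-prime i (suc m) p^[i+1+m]∣UV (p^j∤U ∘ ∣-abs⇒∣ᶻ)
  p^[1+m]∣U : p ^ suc m ∣ ∣ U ∣
  p^[1+m]∣U = p^[i+s]∣m*n⇒p^s∣n p-prime i (suc m)
                (subst (p ^ (i + suc m) ∣_) (*-comm ∣ U ∣ ∣ V ∣) p^[i+1+m]∣UV) (p^j∤V ∘ ∣-abs⇒∣ᶻ)
  p^[2m+2]∣W² : p ^ suc m * p ^ suc m ∣ ∣ W ℤ.* W ∣
  p^[2m+2]∣W² = subst (_ ∣_) (sym (ℤ.abs-* W W)) (*-pres-∣ p^[1+m]∣W p^[1+m]∣W)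
    where
    p^[1+m]∣W : p ^ suc m ∣ ∣ W ∣
    p^[1+m]∣W = ∣⇒∣ᵤ (ℤ∣.∣m∣n⇒∣m-n (∣-abs⇒∣ᶻ {z = V} p^[1+m]∣V) (∣-abs⇒∣ᶻ {z = U} p^[1+m]∣U))
  p^[1+m]∤U : ¬ p ^ suc m ∣ ∣ U ∣
  p^[1+m]∤U p^[1+m]∣U with suc m + suc m ≤? k
  ... | yes 2m+2≤k = p^[2m+2]∤gcd (gcd-greatest p^[2m+2]∣D p^[2m+2]∣p^k)
    where
    p^[2m+2]∣p^k : p ^ suc m * p ^ suc m ∣ p ^ k
    p^[2m+2]∣p^k = subst (_∣ p ^ k) (^-distribˡ-+-* p (suc m) (suc m)) (^-monoʳ-∣ p 2m+2≤k)
    w-[w-d]≡d : ∀ w d → w ℤ.- (w ℤ.- d) ≡ d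
    w-[w-d]≡d = solve-∀
    p^[2m+2]∣D : p ^ suc m * p ^ suc m ∣ ∣ D ∣
    p^[2m+2]∣D = ∣⇒∣ᵤ (subst (_ ∣ᶻ_) (w-[w-d]≡d (W ℤ.* W) D)
      (ℤ∣.∣m∣n⇒∣m-n (∣-abs⇒∣ᶻ {z = W ℤ.* W} p^[2m+2]∣W²)
                    (ℤ∣.∣-trans (∣-abs⇒∣ᶻ p^[2m+2]∣p^k) p^k∣W²-D)))
  ... | no 2m+2≰k = p^j∤U (∣-abs⇒∣ᶻ (∣-trans (^-monoʳ-∣ p 1+i≤1+m) p^[1+m]∣U))
    where
    1+i≤1+m : suc i ≤ suc m
    1+i≤1+m = +-cancelʳ-≤ m (suc i) (suc m)
      (≤-trans (≤-pred (≰⇒> 2m+2≰k)) (≤-reflexive (+-suc m m)))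

F : ℤ → ℕ → ℤ
F a y = + y ℤ.* (+ y ℤ.+ + 1) ℤ.- a

A : ℤ → ℤ
A a = + 4 ℤ.* a ℤ.+ + 1

-- A record rather than a synonym, so that q, a and y are inferable from a proof.
record Root (q : ℕ) (a : ℤ) (y : ℕ) : Set where
  constructor root
  field
    root-divides : q ∣ ∣ F a y ∣

Root⇒∣ᶻ : ∀ {q a y} → Root q a y → + q ∣ᶻ F a y
Root⇒∣ᶻ {q} (root q∣F) = ∣ᵤ⇒∣ {+ q} q∣F

∣ᶻ⇒Root : ∀ {q a y} → + q ∣ᶻ F a y → Root q a y
∣ᶻ⇒Root q∣F = root (∣⇒∣ᵤ q∣F)

root? : ℕ → ℤ → ℕ → Bool
root? q a y = does (q ∣? ∣ F a y ∣)

root?⇒Root : ∀ {q a} y → root? q a y ≡ true → Root q a y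
root?⇒Root {q} {a} y = root ∘ dec-true⁻¹ (q ∣? ∣ F a y ∣)

Root-∣ : ∀ {d q a y} → d ∣ q → Root q a y → Root d a y
Root-∣ d∣q (root q∣F) = root (∣-trans d∣q q∣F)

root?-period : ∀ q a → root? q a q ≡ root? q a 0
root?-period q a =
  does-⇔ (mk⇔ (Root.root-divides ∘ to ∘ root) (Root.root-divides ∘ from ∘ root)) (q ∣? ∣ F a q ∣) (q ∣? ∣ F a 0 ∣)
  where
  F-period : ∀ x a → x ℤ.* (x ℤ.+ + 1) ℤ.- a ≡ (+ 0 ℤ.* (+ 0 ℤ.+ + 1) ℤ.- a) ℤ.+ x ℤ.* (x ℤ.+ + 1)
  F-period = solve-∀
  q∣period : + q ∣ᶻ + q ℤ.* (+ q ℤ.+ + 1)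
  q∣period = ℤ∣.∣m⇒∣m*n (+ q ℤ.+ + 1) ℤ∣.∣-refl
  to : Root q a q → Root q a 0
  to r = ∣ᶻ⇒Root (ℤ∣.∣m+n∣n⇒∣m (subst (+ q ∣ᶻ_) (F-period (+ q) a) (Root⇒∣ᶻ r)) q∣period)
  from : Root q a 0 → Root q a q
  from r = ∣ᶻ⇒Root (subst (+ q ∣ᶻ_) (sym (F-period (+ q) a)) (ℤ∣.∣m∣n⇒∣m+n (Root⇒∣ᶻ r) q∣period))

μ≡count : ∀ q a → μ q a ≡ count (root? q a) q
μ≡count q a = begin
  μ q a
    ≡⟨ cong (length ∘ filter (λ x → q ∣ℤ? F a x)) (map-upTo suc q) ⟩
  length (filter (λ x → q ∣ℤ? F a x) (applyUpTo suc q))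
    ≡⟨ length-filter-applyUpTo (λ x → q ∣ℤ? F a x) suc q ⟩
  count (root? q a ∘ suc) q
    ≡⟨ count-rotate (root? q a) q (root?-period q a) ⟩
  count (root? q a) q
    ∎
  where open ≡-Reasoning

record Splitting (a : ℤ) (q L : ℕ) : Set where
  field
    N M       : ℕ
    key       : ℕ → Vec Bool L
    N*M≡q     : N * M ≡ q
    M*M∣gcd   : M * M ∣ gcd (∣ A a ∣) q
    separates : ∀ {y y'} → Root q a y → Root q a y' → key y ≡ key y' → N ∣ ∣ y - y' ∣

splitting-1 : ∀ {a} → Splitting a 1 0
splitting-1 = record
  { N = 1 ; M = 1 ; key = λ _ → [] ; N*M≡q = refl ; M*M∣gcd = 1∣ _ ; separates = λ _ _ _ → 1∣ _ }

splitting-* : ∀ {a q₁ q₂ L₁ L₂} → Coprime q₁ q₂ →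
              Splitting a q₁ L₁ → Splitting a q₂ L₂ → Splitting a (q₁ * q₂) (L₁ + L₂)
splitting-* {a} {q₁} {q₂} q₁⊥q₂ s₁ s₂ = record
  { N         = N₁ * N₂
  ; M         = M₁ * M₂
  ; key       = λ y → key₁ y Vec.++ key₂ y
  ; N*M≡q     = trans ([m*n]*[o*p]≡[m*o]*[n*p] N₁ N₂ M₁ M₂) (cong₂ _*_ N*M≡q₁ N*M≡q₂)
  ; M*M∣gcd   = subst (_∣ gcd (∣ A a ∣) (q₁ * q₂)) ([m*n]*[o*p]≡[m*o]*[n*p] M₁ M₁ M₂ M₂)
                  (gcd-greatest (coprime⇒*∣ M₁²⊥M₂² (∣-trans M*M∣gcd₁ (gcd[m,n]∣m ∣ A a ∣ q₁))
                                                      (∣-trans M*M∣gcd₂ (gcd[m,n]∣m ∣ A a ∣ q₂)))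
                                (*-pres-∣ M₁²∣q₁ M₂²∣q₂))
  ; separates = λ {y} {y'} y-root y'-root same-key → coprime⇒*∣ N₁⊥N₂
      (separates₁ (Root-∣ (m∣m*n q₂) y-root) (Root-∣ (m∣m*n q₂) y'-root)
                  (++-injectiveˡ (key₁ y) (key₁ y') same-key))
      (separates₂ (Root-∣ (n∣m*n q₁) y-root) (Root-∣ (n∣m*n q₁) y'-root)
                  (++-injectiveʳ (key₁ y) (key₁ y') same-key))
  }
  where
  open Splitting s₁ renaming (N to N₁; M to M₁; key to key₁; N*M≡q to N*M≡q₁;
                              M*M∣gcd to M*M∣gcd₁; separates to separates₁)
  open Splitting s₂ renaming (N to N₂; M to M₂; key to key₂; N*M≡q to N*M≡q₂;
                              M*M∣gcd to M*M∣gcd₂; separates to separates₂)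
  M₁²∣q₁ : M₁ * M₁ ∣ q₁
  M₁²∣q₁ = ∣-trans M*M∣gcd₁ (gcd[m,n]∣n ∣ A a ∣ q₁)
  M₂²∣q₂ : M₂ * M₂ ∣ q₂
  M₂²∣q₂ = ∣-trans M*M∣gcd₂ (gcd[m,n]∣n ∣ A a ∣ q₂)
  M₁²⊥M₂² : Coprime (M₁ * M₁) (M₂ * M₂)
  M₁²⊥M₂² = coprime-∣ q₁⊥q₂ M₁²∣q₁ M₂²∣q₂
  N₁⊥N₂ : Coprime N₁ N₂
  N₁⊥N₂ = coprime-∣ q₁⊥q₂ (subst (N₁ ∣_) N*M≡q₁ (m∣m*n M₁)) (subst (N₂ ∣_) N*M≡q₂ (m∣m*n M₂))

count-roots≤ : ∀ {a q L} (s : Splitting a q L) → count (root? q a) q ≤ 2 ^ L * Splitting.M s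
count-roots≤ {a} {q} s = subst (λ n → count (root? q a) n ≤ _) N*M≡q
  (count-keyed≤ (root? q a) key
     (λ {y} {y'} y-root y'-root → separates (root?⇒Root y y-root) (root?⇒Root y' y'-root)) M)
  where open Splitting s

module PrimePowerSplitting {p} (p-prime : Prime p) {a : ℤ} (j m : ℕ) {k : ℕ} (j+m≡k : j + m ≡ k)
  (p^[2m]∣gcd : p ^ m * p ^ m ∣ gcd (∣ A a ∣) (p ^ k))
  (p^[2m+2]∤gcd : ¬ (p ^ suc m * p ^ suc m ∣ gcd (∣ A a ∣) (p ^ k)))
  {x₀ : ℕ} (x₀-root : Root (p ^ k) a x₀)
  where

  U V : ℕ → ℤ
  U y = + y ℤ.- + x₀
  V y = + y ℤ.+ + x₀ ℤ.+ + 1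

  UV≡F-F : ∀ a y x → (y ℤ.- x) ℤ.* (y ℤ.+ x ℤ.+ + 1) ≡
                     (y ℤ.* (y ℤ.+ + 1) ℤ.- a) ℤ.- (x ℤ.* (x ℤ.+ + 1) ℤ.- a)
  UV≡F-F = solve-∀

  W²-A≡4F : ∀ a y x →
            ((y ℤ.+ x ℤ.+ + 1) ℤ.- (y ℤ.- x)) ℤ.* ((y ℤ.+ x ℤ.+ + 1) ℤ.- (y ℤ.- x)) ℤ.- (+ 4 ℤ.* a ℤ.+ + 1) ≡
            + 4 ℤ.* (x ℤ.* (x ℤ.+ + 1) ℤ.- a)
  W²-A≡4F = solve-∀

  root-factor : ∀ {y} → Root (p ^ k) a y → + (p ^ j) ∣ᶻ U y ⊎ + (p ^ j) ∣ᶻ V y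
  root-factor {y} y-root = prime-power-∣-factor p-prime j m j+m≡k {A a} {U y} {V y} p^[2m+2]∤gcd
    (subst (_ ∣ᶻ_) (sym (UV≡F-F a (+ y) (+ x₀))) (ℤ∣.∣m∣n⇒∣m-n (Root⇒∣ᶻ y-root) (Root⇒∣ᶻ x₀-root)))
    (subst (_ ∣ᶻ_) (sym (W²-A≡4F a (+ y) (+ x₀))) (ℤ∣.∣n⇒∣m*n (+ 4) (Root⇒∣ᶻ x₀-root)))

  U-U≡y-y' : ∀ y y' x → (y ℤ.- x) ℤ.- (y' ℤ.- x) ≡ y ℤ.- y'
  U-U≡y-y' = solve-∀

  V-V≡y-y' : ∀ y y' x → (y ℤ.+ x ℤ.+ + 1) ℤ.- (y' ℤ.+ x ℤ.+ + 1) ≡ y ℤ.- y'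
  V-V≡y-y' = solve-∀

  separates : ∀ {y y'} → Root (p ^ k) a y → Root (p ^ k) a y' →
              Vec.[ does (p ^ j ∣? ∣ U y ∣) ] ≡ Vec.[ does (p ^ j ∣? ∣ U y' ∣) ] → p ^ j ∣ ∣ y - y' ∣
  separates {y} {y'} y-root y'-root same-side
    with p ^ j ∣? ∣ U y ∣ | p ^ j ∣? ∣ U y' ∣ | root-factor y-root | root-factor y'-root
  separates {y} {y'} _ _ _  | yes p^j∣Uy | yes p^j∣Uy' | _ | _ =
    ∣ᶻ⇒∣-distance y y' (subst (_ ∣ᶻ_) (U-U≡y-y' (+ y) (+ y') (+ x₀))
      (ℤ∣.∣m∣n⇒∣m-n (∣-abs⇒∣ᶻ {z = U y} p^j∣Uy) (∣-abs⇒∣ᶻ {z = U y'} p^j∣Uy')))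
  separates {y} {y'} _ _ _  | no _ | no _ | inj₂ p^j∣Vy | inj₂ p^j∣Vy' =
    ∣ᶻ⇒∣-distance y y' (subst (_ ∣ᶻ_) (V-V≡y-y' (+ y) (+ y') (+ x₀)) (ℤ∣.∣m∣n⇒∣m-n p^j∣Vy p^j∣Vy'))
  separates _ _ _  | no p^j∤Uy | _ | inj₁ p^j∣Uy | _ = contradiction (∣⇒∣ᵤ p^j∣Uy) p^j∤Uy
  separates _ _ _  | _ | no p^j∤Uy' | _ | inj₁ p^j∣Uy' = contradiction (∣⇒∣ᵤ p^j∣Uy') p^j∤Uy'
  separates _ _ () | yes _ | no _ | _ | _
  separates _ _ () | no _ | yes _ | _ | _

  splitting : Splitting a (p ^ k) 1
  splitting = record
    { N         = p ^ j
    ; M         = p ^ m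
    ; key       = λ y → Vec.[ does (p ^ j ∣? ∣ U y ∣) ]
    ; N*M≡q     = trans (sym (^-distribˡ-+-* p j m)) (cong (p ^_) j+m≡k)
    ; M*M∣gcd   = p^[2m]∣gcd
    ; separates = separates
    }

prime-power-splitting : ∀ {p} → Prime p → ∀ {a k x₀} → Root (p ^ k) a x₀ → Splitting a (p ^ k) 1
prime-power-splitting {p} p-prime {a} {k} x₀-root
  with m , m<1+k , p^[2m]∣gcd , p^[2m+2]∤gcd ←
         crossing (λ m → p ^ m * p ^ m ∣? gcd (∣ A a ∣) (p ^ k)) (1∣ _)
                  (λ p^[2k+2]∣gcd → p^[1+k]∤p^k p-prime k
                     (∣-trans (m*n∣⇒m∣ _ _ p^[2k+2]∣gcd) (gcd[m,n]∣n ∣ A a ∣ (p ^ k))))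
  = PrimePowerSplitting.splitting p-prime (k ∸ m) m (m∸n+n≡m (≤-pred m<1+k)) p^[2m]∣gcd p^[2m+2]∤gcd x₀-root

Splittable : ℤ → ℕ → Set
Splittable a q = ∃[ L ] L ≤ ω q × Splitting a q L

splittable-step : ∀ {a p q x₀} → .{{NonZero q}} → Prime p → p ∣ q →
                  (∀ {r} → r < q → .{{NonZero r}} → ∀ {x₀} → Root r a x₀ → Splittable a r) →
                  Root q a x₀ → Splittable a q
splittable-step {a} {p} {q} p-prime p∣q splittable-below x₀-root with factor-out p-prime q
... | zero , r , refl , p∤r = contradiction (subst (p ∣_) (+-identityʳ r) p∣q) p∤r
... | suc k , r , refl , p∤r = extend (splittable-below r<q ⦃ r≢0 ⦄ (Root-∣ (n∣m*n (p ^ suc k)) x₀-root))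
  where
  extend : Splittable a r → Splittable a (p ^ suc k * r)
  extend (L , L≤ωr , splitting-r) =
    suc L , ≤-trans (s≤s L≤ωr) (ω-< p-prime p∣q p∤r (n∣m*n (p ^ suc k))) ,
    splitting-* (coprime-^ˡ (prime∤⇒coprime p-prime p∤r) (suc k))
                (prime-power-splitting p-prime {k = suc k} (Root-∣ (m∣m*n r) x₀-root)) splitting-r
  r≢0 : NonZero r
  r≢0 = m*n≢0⇒n≢0 (p ^ suc k)
  r<q : r < p ^ suc k * r
  r<q = subst (r <_) (*-comm r (p ^ suc k)) (m<m*n r (p ^ suc k) ⦃ r≢0 ⦄
          (^-monoʳ-< p (nonTrivial⇒n>1 p ⦃ prime⇒nonTrivial p-prime ⦄) {0} {suc k} z<s))

splittable : ∀ a q → .{{NonZero q}} → ∀ {x₀} → Root q a x₀ → Splittable a q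
splittable a q = <-rec (λ q → .{{NonZero q}} → ∀ {x₀} → Root q a x₀ → Splittable a q) go q
  where
  go : ∀ q → (∀ {r} → r < q → .{{NonZero r}} → ∀ {x₀} → Root r a x₀ → Splittable a r) →
       .{{NonZero q}} → ∀ {x₀} → Root q a x₀ → Splittable a q
  go 1                  _                = λ _ → 0 , z≤n , splitting-1
  go q@(suc (suc _)) splittable-below with p , p-prime , p∣q ← ∃-prime-divisor {q} (s≤s (s≤s z≤n)) =
    splittable-step p-prime p∣q splittable-below

2^n*2^n≡4^n : ∀ n → 2 ^ n * 2 ^ n ≡ 4 ^ n
2^n*2^n≡4^n zero    = refl
2^n*2^n≡4^n (suc n) = trans ([m*n]*[o*p]≡[m*o]*[n*p] 2 (2 ^ n) 2 (2 ^ n)) (cong (4 *_) (2^n*2^n≡4^n n))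

count-roots²≤ : ∀ a q → .{{NonZero q}} → count (root? q a) q * count (root? q a) q ≤ 4 ^ ω q * gcd (∣ A a ∣) q
count-roots²≤ a q with count≡0⊎witness (root? q a) q
... | inj₁ no-roots rewrite no-roots = z≤n
... | inj₂ (x₀ , x₀-root) with L , L≤ωq , s ← splittable a q (root?⇒Root x₀ x₀-root) = begin
  count (root? q a) q * count (root? q a) q ≤⟨ *-mono-≤ (count-roots≤ s) (count-roots≤ s) ⟩
  (2 ^ L * M) * (2 ^ L * M)                 ≡⟨ [m*n]*[o*p]≡[m*o]*[n*p] (2 ^ L) M (2 ^ L) M ⟩
  (2 ^ L * 2 ^ L) * (M * M)                 ≡⟨ cong (_* (M * M)) (2^n*2^n≡4^n L) ⟩
  4 ^ L * (M * M)                           ≤⟨ *-mono-≤ (^-monoʳ-≤ 4 L≤ωq) (∣⇒≤ ⦃ gcd≢0 ⦄ M*M∣gcd) ⟩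
  4 ^ ω q * gcd (∣ A a ∣) q                 ∎
  where
  open ≤-Reasoning
  open Splitting s
  gcd≢0 : NonZero (gcd (∣ A a ∣) q)
  gcd≢0 = ≢-nonZero (gcd[m,n]≢0 ∣ A a ∣ q (inj₂ (≢-nonZero⁻¹ q)))

corollary2 : (q : ℕ) → 2 ≤ q → (a : ℤ) →
    μ q a * μ q a ≤ 16 * (4 ^ ω q) * gcd ∣ (+ 4) ℤ.* a ℤ.+ + 1 ∣ q
corollary2 q 2≤q a = begin
  μ q a * μ q a                             ≡⟨ cong (λ n → n * n) (μ≡count q a) ⟩
  count (root? q a) q * count (root? q a) q ≤⟨ count-roots²≤ a q ⟩
  4 ^ ω q * gcd (∣ A a ∣) q                 ≤⟨ m≤n*m _ 16 ⟩
  16 * (4 ^ ω q * gcd (∣ A a ∣) q)          ≡⟨ *-assoc 16 (4 ^ ω q) _ ⟨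
  16 * 4 ^ ω q * gcd (∣ A a ∣) q            ∎
  where
  open ≤-Reasoning
  instance
    q≢0 : NonZero q
    q≢0 = >-nonZero (≤-trans (s≤s z≤n) 2≤q)
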